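{- Let $u$ and $v$ be finite nonempty words over the positive integers $\mathbb{P}$. If $u$ and $v$ are shift equivalent, then $u$ and $v$ are strongly Wilf equivalent, i.e. $A_u(x,y,z)=A_v(x,y,z)$.
   Context: Words are finite sequences $w=w_1w_2\cdots w_n$ of positive integers; $|w|=n$ is the length and $\|w\|=w_1+\cdots+w_n$ is the sum. For nonempty words $u=u_1\cdots u_k$ and $w$, an embedding of $u$ in $w$ is a factor (consecutive block of letters) $w_{j+1}w_{j+2}\cdots w_{j+k}$ of $w$ such that $u_i\le w_{j+i}$ for all $i=1,\dots,k$. Let $\eta_u(w)$ be the number of embeddings of $u$ in $w$ (i.e. the number of starting positions $j$ for which this holds). Define $$A_u(x,y,z)=\sum_{w\in\mathbb{P}^*} x^{|w|}y^{\|w\|}z^{\eta_u(w)},$$ the sum over all words $w$ over $\mathbb{P}$. Two words $u,v$ are strongly Wilf equivalent if $A_u(x,y,z)=A_v(x,y,z)$. Skyline diagram: the word $u=u_1\cdots u_n$ is pictured as $n$ adjacent columns of unit squares, column $i$ consisting of $u_i$ squares stacked from the ground. A rigid shift of $u$ is a word $v$ obtained by cutting the skyline diagram of $u$ at some height $h$ (a positive integer) and rigidly translating all squares above height $h$ horizontally by the same integer $k$ columns, in such a way that every moved column comes to rest on a column whose height after the cut is exactly $h$. Algebraically: with the convention $u_n=0$ for $n<1$ or $n>|u|$, the translation is admissible when for every $n$ with $u_n>h$ one has $1\le n+k\le |u|$ and $u_{n+k}\ge h$, and then $v$ is the word of length $|u|$ with letters $v_n=\min(h,u_n)+\max(0,u_{n-k}-h)$.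 The reversal of $u=u_1\cdots u_n$ is $u_n\cdots u_1$. Two words are shift equivalent if one can be obtained from the other by a finite sequence of reversals and rigid shifts. -}

module Defs where

open import Data.Nat as ℕ using (ℕ; zero; suc; _≤_; _<_; _⊔_; _⊓_; _∸_; _+_)
open import Data.Integer as ℤ using (ℤ; +_; -[1+_])
open import Data.List using (List; []; _∷_; length; reverse; applyUpTo)
open import Data.Nat.ListAction using (sum)
open import Data.List.Relation.Unary.All using (All)
open import Data.Product using (Σ; ∃; _×_)
open import Data.Sum using (_⊎_)
open import Data.Bool using (Bool; true; false; _∧_; if_then_else_)
open import Relation.Nullary.Decidable using (⌊_⌋)
open import Relation.Binary.PropositionalEquality using (_≡_)
open import Relation.Binary.Construct.Closure.ReflexiveTransitive using (Star)
open import Function.Bundles using (_↔_)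

Word : Set
Word = List ℕ

Positive : Word → Set
Positive w = All (λ a → 1 ≤ a) w

Nonempty : Word → Set
Nonempty w = 1 ≤ length w

prefixLE : Word → Word → Bool
prefixLE []       _        = true
prefixLE (_ ∷ _)  []       = false
prefixLE (a ∷ u)  (b ∷ w)  = ⌊ a ℕ.≤? b ⌋ ∧ prefixLE u w

η : Word → Word → ℕ
η u []        = if prefixLE u [] then 1 else 0
η u (b ∷ w)   = (if prefixLE u (b ∷ w) then 1 else 0) + η u w
-- (for nonempty u, the [] case contributes 0)

-- Coeff u n s k is the set of words w over ℙ with |w| = n, ‖w‖ = s and
-- η_u(w) = k; its (finite) cardinality is the coefficient of x^n y^s z^k
-- in A_u(x,y,z).

Coeff : Word → ℕ → ℕ → ℕ → Set
Coeff u n s k = Σ Word (λ w → Positive w × length w ≡ n × sum w ≡ s × η u w ≡ k)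

-- A_u = A_v : all coefficients agree, i.e. the finite sets have the same
-- cardinality, i.e. are in bijection.
StronglyWilfEquivalent : Word → Word → Set
StronglyWilfEquivalent u v = ∀ n s k → Coeff u n s k ↔ Coeff v n s k

lookupD : Word → ℕ → ℕ
lookupD []      _       = 0
lookupD (a ∷ _) zero    = a
lookupD (_ ∷ u) (suc i) = lookupD u i

-- u_n for n : ℤ, 1-indexed, with u_n = 0 for n < 1 or n > |u|
at : Word → ℤ → ℕ
at u (+ zero)  = 0
at u (+ suc i) = lookupD u i
at u -[1+ _ ]  = 0

Admissible : Word → ℕ → ℤ → Set
Admissible u h k = ∀ (n : ℤ) → h < at u n →
  (+ 1 ℤ.≤ n ℤ.+ k) × (n ℤ.+ k ℤ.≤ + length u) × (h ≤ at u (n ℤ.+ k))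

shift : Word → ℕ → ℤ → Word
shift u h k = applyUpTo (λ i → (h ⊓ at u (+ suc i)) + (at u (+ suc i ℤ.- k) ∸ h)) (length u)

RigidShift : Word → Word → Set
RigidShift u v = Σ ℕ (λ h → 1 ≤ h × Σ ℤ (λ k → Admissible u h k × v ≡ shift u h k))

Step : Word → Word → Set
Step u v = v ≡ reverse u ⊎ RigidShift u v

ShiftEquivalent : Word → Word → Set
ShiftEquivalent u v = Star Step u v ⊎ Star Step v u

-- Let N_u(S) be the number of words w of given length and sum in which u embeds at every
-- position of the set S. By Möbius inversion on the Boolean lattice of position sets, the
-- numbers N_u(S) determine how many such w have exactly k embeddings of u. Now u embeds at
-- all positions of S iff w dominates the superposition M of the copies of u placed at S
-- (their pointwise maximum), and the number of positive words of length n and sum s that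
-- dominate M depends only on |M| and on the excess Σᵢ (Mᵢ ∸ 1). Cutting at height h ≥ 1
-- splits the excess of M into that of its part below h plus the sum of its part above h.
-- A rigid shift at height h leaves the part of every superposition below h unchanged and
-- only translates the part above h, so N_u = N_v. Reversal maps embeddings in w to
-- embeddings of the reversed word in the reversed w.
module Submission where

open import Defs

open import Algebra.Bundles using (CommutativeMonoid; AbelianGroup)
import Algebra.Properties.CommutativeSemigroup as CommutativeSemigroupProperties
open import Data.Bool using (Bool; true; false; _∧_; _∨_; not; if_then_else_)
import Data.Bool.Properties as Bool
open import Data.Fin as Fin using (Fin)
import Data.Fin.Properties as Finₚ
open import Data.Integer as ℤ using (ℤ; -[1+_]; _⊖_)
import Data.Integer.Properties as ℤₚ
open import Data.List using (List; []; _∷_; length; map; _++_; _∷ʳ_; replicate; reverse; applyUpTo)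
open import Data.List.Properties using
  (map-++; map-replicate; length-applyUpTo; length-++; length-reverse; unfold-reverse; reverse-++; reverse-involutive)
import Data.List.Relation.Unary.All as All
open import Data.List.Relation.Unary.All using ([]; _∷_)
open import Data.List.Relation.Binary.Permutation.Propositional using (↭-sym)
open import Data.List.Relation.Binary.Permutation.Propositional.Properties using (↭-reverse; All-resp-↭)
open import Data.Nat as ℕ using (ℕ; zero; suc; pred; _≤_; _<_; _⊔_; _⊓_; _∸_; _+_; _*_; z≤n; s≤s; _≤ᵇ_)
open import Data.Nat.Properties
open import Data.Nat.ListAction using (sum)
open import Data.Nat.ListAction.Properties using (sum-↭)
open import Data.Product using (Σ; _×_; _,_; proj₁; proj₂)
open import Data.Sum using (_⊎_; inj₁; inj₂)
open import Data.Sum.Function.Propositional using (_⊎-↔_)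
open import Function using (_∘_)
open import Function.Bundles using (_↔_; mk↔ₛ′)
open import Function.Properties.Inverse using (↔-refl; ↔-sym; ↔-trans)
open import Level using (0ℓ)
open import Relation.Binary.Bundles using (Setoid)
open import Relation.Binary.Construct.Closure.ReflexiveTransitive using (Star; ε; _◅_)
open import Relation.Binary.Definitions using (tri<; tri≈; tri>)
open import Relation.Binary.PropositionalEquality
import Relation.Binary.Reasoning.Setoid as SetoidReasoning
open import Relation.Nullary using (¬_; Dec; does; yes; no; contradiction; Irrelevant)
open import Relation.Nullary.Decidable using (⌊_⌋; isYes≗does; dec-true; dec-false)
import Relation.Unary as U

open CommutativeSemigroupProperties +-commutativeSemigroup
  using (x∙yz≈xz∙y; xy∙z≈xz∙y) renaming (interchange to +-interchange)
open CommutativeSemigroupProperties (CommutativeMonoid.commutativeSemigroup Bool.∧-commutativeMonoid)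
  using () renaming (interchange to ∧-interchange)
open import Algebra.Properties.Group (AbelianGroup.group ℤₚ.+-0-abelianGroup) using (//-rightDividesˡ)

𝟙 : Bool → ℕ
𝟙 b = if b then 1 else 0

incrHead : Word → Word
incrHead []      = []
incrHead (a ∷ w) = suc a ∷ w

length-incrHead : ∀ w → length (incrHead w) ≡ length w
length-incrHead []      = refl
length-incrHead (a ∷ w) = refl

-- ΣWord n s f is the sum of f over the positive words of length n and sum s:
-- those starting with 1 are 1 ∷ w, the others are incrHead w.
ΣWord : ℕ → ℕ → (Word → ℕ) → ℕ
ΣWord zero    zero    f = f []
ΣWord zero    (suc s) f = 0
ΣWord (suc n) zero    f = 0
ΣWord (suc n) (suc s) f = ΣWord n s (f ∘ (1 ∷_)) + ΣWord (suc n) s (f ∘ incrHead)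

ΣWord-cong : ∀ n s {f g : Word → ℕ} → (∀ w → length w ≡ n → f w ≡ g w) →
             ΣWord n s f ≡ ΣWord n s g
ΣWord-cong zero    zero    f≗g = f≗g [] refl
ΣWord-cong zero    (suc s) f≗g = refl
ΣWord-cong (suc n) zero    f≗g = refl
ΣWord-cong (suc n) (suc s) f≗g = cong₂ _+_
  (ΣWord-cong n s λ w |w| → f≗g (1 ∷ w) (cong suc |w|))
  (ΣWord-cong (suc n) s λ w |w| → f≗g (incrHead w) (trans (length-incrHead w) |w|))

ΣWord-+ : ∀ n s (f g : Word → ℕ) → ΣWord n s (λ w → f w + g w) ≡ ΣWord n s f + ΣWord n s g
ΣWord-+ zero    zero    f g = refl
ΣWord-+ zero    (suc s) f g = refl
ΣWord-+ (suc n) zero    f g = refl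
ΣWord-+ (suc n) (suc s) f g = trans
  (cong₂ _+_ (ΣWord-+ n s _ _) (ΣWord-+ (suc n) s _ _))
  (+-interchange (ΣWord n s _) _ _ _)

ΣWord-*ˡ : ∀ n s c (f : Word → ℕ) → ΣWord n s (λ w → c * f w) ≡ c * ΣWord n s f
ΣWord-*ˡ zero    zero    c f = refl
ΣWord-*ˡ zero    (suc s) c f = sym (*-zeroʳ c)
ΣWord-*ˡ (suc n) zero    c f = sym (*-zeroʳ c)
ΣWord-*ˡ (suc n) (suc s) c f = trans
  (cong₂ _+_ (ΣWord-*ˡ n s c _) (ΣWord-*ˡ (suc n) s c _))
  (sym (*-distribˡ-+ c _ _))

-- Subsets of the positions of a word of length n are Boolean lists of length n.
Subset : Set
Subset = List Bool

ΣSubset : ℕ → (Subset → ℕ) → ℕ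
ΣSubset zero    g = g []
ΣSubset (suc m) g = ΣSubset m (g ∘ (true ∷_)) + ΣSubset m (g ∘ (false ∷_))

ΣSubset-cong : ∀ m {g g' : Subset → ℕ} → (∀ S → length S ≡ m → g S ≡ g' S) →
               ΣSubset m g ≡ ΣSubset m g'
ΣSubset-cong zero    g≗g' = g≗g' [] refl
ΣSubset-cong (suc m) g≗g' = cong₂ _+_
  (ΣSubset-cong m λ S |S| → g≗g' (true ∷ S) (cong suc |S|))
  (ΣSubset-cong m λ S |S| → g≗g' (false ∷ S) (cong suc |S|))

ΣSubset-+ : ∀ m (g g' : Subset → ℕ) → ΣSubset m (λ S → g S + g' S) ≡ ΣSubset m g + ΣSubset m g'
ΣSubset-+ zero    g g' = refl
ΣSubset-+ (suc m) g g' = trans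
  (cong₂ _+_ (ΣSubset-+ m _ _) (ΣSubset-+ m _ _))
  (+-interchange (ΣSubset m _) _ _ _)

ΣSubset-0 : ∀ m → ΣSubset m (λ _ → 0) ≡ 0
ΣSubset-0 zero    = refl
ΣSubset-0 (suc m) = cong₂ _+_ (ΣSubset-0 m) (ΣSubset-0 m)

ΣWord-ΣSubset : ∀ n s m (F : Subset → Word → ℕ) →
                ΣWord n s (λ w → ΣSubset m (λ S → F S w)) ≡ ΣSubset m (λ S → ΣWord n s (F S))
ΣWord-ΣSubset n s zero    F = refl
ΣWord-ΣSubset n s (suc m) F = trans (ΣWord-+ n s _ _)
  (cong₂ _+_ (ΣWord-ΣSubset n s m _) (ΣWord-ΣSubset n s m _))

-- Möbius inversion on the Boolean lattice

infix 4 _=ˢ_ _⊆ˢ_ _⊂ˢ_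

_=ˢ_ : Subset → Subset → Bool
[]      =ˢ []      = true
(a ∷ S) =ˢ (b ∷ T) = does (a Bool.≟ b) ∧ (S =ˢ T)
_       =ˢ _       = false

_⊆ˢ_ : Subset → Subset → Bool
[]      ⊆ˢ []      = true
(a ∷ S) ⊆ˢ (b ∷ T) = (not a ∨ b) ∧ (S ⊆ˢ T)
_       ⊆ˢ _       = false

_⊂ˢ_ : Subset → Subset → Bool
S ⊂ˢ T = (S ⊆ˢ T) ∧ not (S =ˢ T)

ΣSubset-=ˢ : ∀ X (g : Subset → ℕ) → ΣSubset (length X) (λ S → 𝟙 (X =ˢ S) * g S) ≡ g X
ΣSubset-=ˢ []          g = +-identityʳ (g [])
ΣSubset-=ˢ (true ∷ X)  g = trans
  (cong₂ _+_ (ΣSubset-=ˢ X (g ∘ (true ∷_))) (ΣSubset-0 (length X)))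
  (+-identityʳ _)
ΣSubset-=ˢ (false ∷ X) g =
  cong₂ _+_ (ΣSubset-0 (length X)) (ΣSubset-=ˢ X (g ∘ (false ∷_)))

missing : Subset → ℕ
missing []          = 0
missing (true ∷ S)  = missing S
missing (false ∷ S) = suc (missing S)

=ˢ⇒⊆ˢ : ∀ S T → (S =ˢ T) ≡ true → (S ⊆ˢ T) ≡ true
=ˢ⇒⊆ˢ []          []          _   = refl
=ˢ⇒⊆ˢ (true ∷ S)  (true ∷ T)  S=T = =ˢ⇒⊆ˢ S T S=T
=ˢ⇒⊆ˢ (false ∷ S) (false ∷ T) S=T = =ˢ⇒⊆ˢ S T S=T

⊆ˢ⇒missing-≥ : ∀ S T → (S ⊆ˢ T) ≡ true → missing T ≤ missing S
⊆ˢ⇒missing-≥ []          []          _   = z≤n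
⊆ˢ⇒missing-≥ (true ∷ S)  (true ∷ T)  S⊆T = ⊆ˢ⇒missing-≥ S T S⊆T
⊆ˢ⇒missing-≥ (false ∷ S) (true ∷ T)  S⊆T = m≤n⇒m≤1+n (⊆ˢ⇒missing-≥ S T S⊆T)
⊆ˢ⇒missing-≥ (false ∷ S) (false ∷ T) S⊆T = s≤s (⊆ˢ⇒missing-≥ S T S⊆T)

⊂ˢ⇒missing-> : ∀ S T → (S ⊂ˢ T) ≡ true → missing T < missing S
⊂ˢ⇒missing-> []          []          ()
⊂ˢ⇒missing-> (true ∷ S)  (true ∷ T)  S⊂T = ⊂ˢ⇒missing-> S T S⊂T
⊂ˢ⇒missing-> (false ∷ S) (false ∷ T) S⊂T = s≤s (⊂ˢ⇒missing-> S T S⊂T)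
⊂ˢ⇒missing-> (false ∷ S) (true ∷ T)  S⊂T =
  s≤s (⊆ˢ⇒missing-≥ S T (trans (sym (Bool.∧-identityʳ _)) S⊂T))

𝟙-⊆ˢ : ∀ S T → 𝟙 (S ⊆ˢ T) ≡ 𝟙 (S =ˢ T) + 𝟙 (S ⊂ˢ T)
𝟙-⊆ˢ S T with S =ˢ T in S=T | S ⊆ˢ T in S⊆T
... | true  | true  = refl
... | true  | false = contradiction (trans (sym S⊆T) (=ˢ⇒⊆ˢ S T S=T)) λ ()
... | false | _     = cong 𝟙 (sym (Bool.∧-identityʳ _))

upperSum : ℕ → (Subset → ℕ) → Subset → ℕ
upperSum n f S = ΣSubset n (λ T → 𝟙 (S ⊆ˢ T) * f T)

strictUpperSum : ℕ → (Subset → ℕ) → Subset → ℕ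
strictUpperSum n f S = ΣSubset n (λ T → 𝟙 (S ⊂ˢ T) * f T)

upperSum-split : ∀ (f : Subset → ℕ) S → upperSum (length S) f S ≡ f S + strictUpperSum (length S) f S
upperSum-split f S = begin
  ΣSubset n (λ T → 𝟙 (S ⊆ˢ T) * f T)
    ≡⟨ ΣSubset-cong n (λ T _ → cong (_* f T) (𝟙-⊆ˢ S T)) ⟩
  ΣSubset n (λ T → (𝟙 (S =ˢ T) + 𝟙 (S ⊂ˢ T)) * f T)
    ≡⟨ ΣSubset-cong n (λ T _ → *-distribʳ-+ (f T) (𝟙 (S =ˢ T)) _) ⟩
  ΣSubset n (λ T → 𝟙 (S =ˢ T) * f T + 𝟙 (S ⊂ˢ T) * f T)
    ≡⟨ ΣSubset-+ n _ _ ⟩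
  ΣSubset n (λ T → 𝟙 (S =ˢ T) * f T) + strictUpperSum n f S
    ≡⟨ cong (_+ strictUpperSum n f S) (ΣSubset-=ˢ S f) ⟩
  f S + strictUpperSum n f S ∎
  where
  open ≡-Reasoning
  n = length S

-- Induction on the number of positions missing from S: upperSum n f S is f S plus
-- the values of f strictly above S.
upperSum-injective : ∀ n {f g : Subset → ℕ} →
  (∀ S → length S ≡ n → upperSum n f S ≡ upperSum n g S) →
  ∀ S → length S ≡ n → f S ≡ g S
upperSum-injective n {f} {g} f↑≡g↑ S |S| = go (suc (missing S)) S |S| ≤-refl
  where
  open ≡-Reasoning
  go : ∀ d S → length S ≡ n → missing S < d → f S ≡ g S
  go (suc d) S refl (s≤s S≤d) = +-cancelʳ-≡ (strictUpperSum n g S) (f S) (g S) (begin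
    f S + strictUpperSum n g S ≡⟨ cong (f S +_) (ΣSubset-cong n above) ⟨
    f S + strictUpperSum n f S ≡⟨ upperSum-split f S ⟨
    upperSum n f S             ≡⟨ f↑≡g↑ S refl ⟩
    upperSum n g S             ≡⟨ upperSum-split g S ⟩
    g S + strictUpperSum n g S ∎)
    where
    above : ∀ T → length T ≡ n → 𝟙 (S ⊂ˢ T) * f T ≡ 𝟙 (S ⊂ˢ T) * g T
    above T |T| with S ⊂ˢ T in S⊂T
    ... | true  = cong (_+ 0) (go d T |T| (≤-trans (⊂ˢ⇒missing-> S T S⊂T) S≤d))
    ... | false = refl

excess : Word → ℕ
excess M = sum (map pred M)

-- #words∸ n s t counts the positive words of length n and sum s ∸ t (none if s < t).
#words∸ : ℕ → ℕ → ℕ → ℕ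
#words∸ n s       zero    = ΣWord n s (λ _ → 1)
#words∸ n zero    (suc t) = 0
#words∸ n (suc s) (suc t) = #words∸ n s t

#words∸-suc : ∀ n s t → #words∸ (suc n) (suc s) t ≡ #words∸ n s t + #words∸ (suc n) s t
#words∸-suc n s       zero          = refl
#words∸-suc n zero    (suc zero)    = refl
#words∸-suc n zero    (suc (suc t)) = refl
#words∸-suc n (suc s) (suc t)       = #words∸-suc n s t

#words∸-zero : ∀ n t → #words∸ (suc n) 0 t ≡ 0
#words∸-zero n zero    = refl
#words∸-zero n (suc t) = refl

≤ᵇ-suc : ∀ m n → (suc m ≤ᵇ suc n) ≡ (m ≤ᵇ n)
≤ᵇ-suc zero    n = refl
≤ᵇ-suc (suc m) n = refl

≤ᵇ-pred : ∀ m n → (m ≤ᵇ suc n) ≡ (pred m ≤ᵇ n)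
≤ᵇ-pred zero          n = refl
≤ᵇ-pred (suc zero)    n = refl
≤ᵇ-pred (suc (suc m)) n = refl

prefixLE-incrHead : ∀ m M w → prefixLE (m ∷ M) (incrHead w) ≡ prefixLE (pred m ∷ M) w
prefixLE-incrHead m M []      = refl
prefixLE-incrHead m M (c ∷ w) = cong (_∧ prefixLE M w) (begin
  ⌊ m ℕ.≤? suc c ⌋   ≡⟨ isYes≗does (m ℕ.≤? suc c) ⟩
  m ≤ᵇ suc c         ≡⟨ ≤ᵇ-pred m c ⟩
  pred m ≤ᵇ c        ≡⟨ isYes≗does (pred m ℕ.≤? c) ⟨
  ⌊ pred m ℕ.≤? c ⌋ ∎)
  where open ≡-Reasoning

ΣWord-prefixLE-step : ∀ n s m M →
  ΣWord (suc n) (suc s) (λ w → 𝟙 (prefixLE (m ∷ M) w)) ≡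
  ΣWord n s (λ w → 𝟙 (⌊ m ℕ.≤? 1 ⌋ ∧ prefixLE M w)) +
  ΣWord (suc n) s (λ w → 𝟙 (prefixLE (pred m ∷ M) w))
ΣWord-prefixLE-step n s m M =
  cong (ΣWord n s _ +_) (ΣWord-cong (suc n) s λ w _ → cong 𝟙 (prefixLE-incrHead m M w))

ΣWord-prefixLE : ∀ n s M →
  ΣWord n s (λ w → 𝟙 (prefixLE M w)) ≡ 𝟙 (length M ≤ᵇ n) * #words∸ n s (excess M)
ΣWord-prefixLE-lowHead : ∀ n s M →
  ΣWord n s (λ w → 𝟙 (prefixLE M w)) + ΣWord (suc n) s (λ w → 𝟙 (prefixLE (0 ∷ M) w)) ≡
  𝟙 (length (0 ∷ M) ≤ᵇ suc n) * #words∸ (suc n) (suc s) (excess M)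

ΣWord-prefixLE n       s       []      = sym (+-identityʳ _)
ΣWord-prefixLE zero    zero    (m ∷ M) = refl
ΣWord-prefixLE zero    (suc s) (m ∷ M) = refl
ΣWord-prefixLE (suc n) zero    (m ∷ M) = sym (trans (cong (B *_) (#words∸-zero n (excess (m ∷ M)))) (*-zeroʳ B))
  where B = 𝟙 (length (m ∷ M) ≤ᵇ suc n)
ΣWord-prefixLE (suc n) (suc s) (0 ∷ M) =
  trans (ΣWord-prefixLE-step n s 0 M) (ΣWord-prefixLE-lowHead n s M)
ΣWord-prefixLE (suc n) (suc s) (1 ∷ M) =
  trans (ΣWord-prefixLE-step n s 1 M) (ΣWord-prefixLE-lowHead n s M)
ΣWord-prefixLE (suc n) (suc s) (suc (suc m) ∷ M) =
  trans (ΣWord-prefixLE-step n s (2 + m) M)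
        (cong₂ _+_ (ΣWord-*ˡ n s 0 (λ _ → 0)) (ΣWord-prefixLE (suc n) s (suc m ∷ M)))

ΣWord-prefixLE-lowHead n s M = begin
  ΣWord n s (λ w → 𝟙 (prefixLE M w)) + ΣWord (suc n) s (λ w → 𝟙 (prefixLE (0 ∷ M) w))
    ≡⟨ cong₂ _+_ (ΣWord-prefixLE n s M) (ΣWord-prefixLE (suc n) s (0 ∷ M)) ⟩
  𝟙 (length M ≤ᵇ n) * #words∸ n s e + B * #words∸ (suc n) s e
    ≡⟨ cong (λ b → 𝟙 b * #words∸ n s e + B * #words∸ (suc n) s e) (≤ᵇ-suc (length M) n) ⟨
  B * #words∸ n s e + B * #words∸ (suc n) s e
    ≡⟨ *-distribˡ-+ B _ _ ⟨
  B * (#words∸ n s e + #words∸ (suc n) s e)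
    ≡⟨ cong (B *_) (#words∸-suc n s e) ⟨
  B * #words∸ (suc n) (suc s) e ∎
  where
  open ≡-Reasoning
  e = excess M
  B = 𝟙 (length (0 ∷ M) ≤ᵇ suc n)

-- Superpositions of occurrences

infixl 6 _⊔ˡ_

_⊔ˡ_ : Word → Word → Word
[]      ⊔ˡ B       = B
(a ∷ A) ⊔ˡ []      = a ∷ A
(a ∷ A) ⊔ˡ (b ∷ B) = a ⊔ b ∷ A ⊔ˡ B

copy : Bool → Word → Word
copy b u = if b then u else []

-- The pointwise maximum of the copies of u placed at the positions in S.
superpose : Word → Subset → Word
superpose u []      = []
superpose u (b ∷ S) = copy b u ⊔ˡ (0 ∷ superpose u S)

occurrences : Word → Word → Subset
occurrences u []      = []
occurrences u (c ∷ w) = prefixLE u (c ∷ w) ∷ occurrences u w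

length-occurrences : ∀ u w → length (occurrences u w) ≡ length w
length-occurrences u []      = refl
length-occurrences u (c ∷ w) = cong suc (length-occurrences u w)

⌊⊔≤?⌋ : ∀ a b c → ⌊ a ⊔ b ℕ.≤? c ⌋ ≡ ⌊ a ℕ.≤? c ⌋ ∧ ⌊ b ℕ.≤? c ⌋
⌊⊔≤?⌋ a b c with a ℕ.≤? c | b ℕ.≤? c
... | yes a≤c | yes b≤c = trans (isYes≗does _) (dec-true (a ⊔ b ℕ.≤? c) (⊔-lub a≤c b≤c))
... | yes _   | no  b≰c = trans (isYes≗does _) (dec-false (a ⊔ b ℕ.≤? c) (b≰c ∘ ≤-trans (m≤n⊔m a b)))
... | no  a≰c | _       = trans (isYes≗does _) (dec-false (a ⊔ b ℕ.≤? c) (a≰c ∘ ≤-trans (m≤m⊔n a b)))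

prefixLE-⊔ˡ : ∀ A B w → prefixLE (A ⊔ˡ B) w ≡ prefixLE A w ∧ prefixLE B w
prefixLE-⊔ˡ []      B       w       = refl
prefixLE-⊔ˡ (a ∷ A) []      w       = sym (Bool.∧-identityʳ _)
prefixLE-⊔ˡ (a ∷ A) (b ∷ B) []      = refl
prefixLE-⊔ˡ (a ∷ A) (b ∷ B) (c ∷ w) = trans
  (cong₂ _∧_ (⌊⊔≤?⌋ a b c) (prefixLE-⊔ˡ A B w))
  (∧-interchange ⌊ a ℕ.≤? c ⌋ _ _ _)

⊆ˢ-occurrences : ∀ u S w → length S ≡ length w →
                 (S ⊆ˢ occurrences u w) ≡ prefixLE (superpose u S) w
⊆ˢ-occurrences u []      []      _     = refl
⊆ˢ-occurrences u (b ∷ S) (c ∷ w) |S|≡ = sym (trans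
  (prefixLE-⊔ˡ (copy b u) (0 ∷ superpose u S) (c ∷ w))
  (cong₂ _∧_ (prefixLE-copy b) (sym (⊆ˢ-occurrences u S w (suc-injective |S|≡)))))
  where
  prefixLE-copy : ∀ b → prefixLE (copy b u) (c ∷ w) ≡ not b ∨ prefixLE u (c ∷ w)
  prefixLE-copy true  = refl
  prefixLE-copy false = refl

length-⊔ˡ : ∀ A B → length (A ⊔ˡ B) ≡ length A ⊔ length B
length-⊔ˡ []      B       = refl
length-⊔ˡ (a ∷ A) []      = sym (⊔-identityʳ (suc (length A)))
length-⊔ˡ (a ∷ A) (b ∷ B) = cong suc (length-⊔ˡ A B)

length-superpose : ∀ {u v} → length u ≡ length v → ∀ S →
                   length (superpose u S) ≡ length (superpose v S)
length-superpose |u|≡|v| []      = refl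
length-superpose {u} {v} |u|≡|v| (b ∷ S) = begin
  length (copy b u ⊔ˡ (0 ∷ superpose u S))
    ≡⟨ length-⊔ˡ (copy b u) _ ⟩
  length (copy b u) ⊔ suc (length (superpose u S))
    ≡⟨ cong₂ _⊔_ (length-copy b) (cong suc (length-superpose |u|≡|v| S)) ⟩
  length (copy b v) ⊔ suc (length (superpose v S))
    ≡⟨ length-⊔ˡ (copy b v) _ ⟨
  length (copy b v ⊔ˡ (0 ∷ superpose v S)) ∎
  where
  open ≡-Reasoning
  length-copy : ∀ b → length (copy b u) ≡ length (copy b v)
  length-copy true  = |u|≡|v|
  length-copy false = refl

infix 4 _≐_

-- Equality up to trailing zeros; a record, so that both words can be inferred.
record _≐_ (A B : Word) : Set where
  constructor lookupD-≐
  field lookupD-≡ : ∀ p → lookupD A p ≡ lookupD B p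
open _≐_

≐-setoid : Setoid 0ℓ 0ℓ
≐-setoid = record
  { Carrier       = Word
  ; _≈_           = _≐_
  ; isEquivalence = record
    { refl  = lookupD-≐ λ _ → refl
    ; sym   = λ A≐B → lookupD-≐ λ p → sym (lookupD-≡ A≐B p)
    ; trans = λ A≐B B≐C → lookupD-≐ λ p → trans (lookupD-≡ A≐B p) (lookupD-≡ B≐C p)
    }
  }

open Setoid ≐-setoid using () renaming (refl to ≐-refl; sym to ≐-sym; trans to ≐-trans)
module ≐-Reasoning = SetoidReasoning ≐-setoid

∷-≐ : ∀ a {A B} → A ≐ B → a ∷ A ≐ a ∷ B
∷-≐ a A≐B = lookupD-≐ λ { zero → refl ; (suc p) → lookupD-≡ A≐B p }

lookupD-⊔ˡ : ∀ A B p → lookupD (A ⊔ˡ B) p ≡ lookupD A p ⊔ lookupD B p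
lookupD-⊔ˡ []      B       p       = refl
lookupD-⊔ˡ (a ∷ A) []      zero    = sym (⊔-identityʳ a)
lookupD-⊔ˡ (a ∷ A) []      (suc p) = sym (⊔-identityʳ (lookupD A p))
lookupD-⊔ˡ (a ∷ A) (b ∷ B) zero    = refl
lookupD-⊔ˡ (a ∷ A) (b ∷ B) (suc p) = lookupD-⊔ˡ A B p

⊔ˡ-≐ : ∀ {A A' B B'} → A ≐ A' → B ≐ B' → A ⊔ˡ B ≐ A' ⊔ˡ B'
⊔ˡ-≐ {A} {A'} {B} {B'} A≐A' B≐B' = lookupD-≐ λ p → begin
  lookupD (A ⊔ˡ B) p           ≡⟨ lookupD-⊔ˡ A B p ⟩
  lookupD A p ⊔ lookupD B p     ≡⟨ cong₂ _⊔_ (lookupD-≡ A≐A' p) (lookupD-≡ B≐B' p) ⟩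
  lookupD A' p ⊔ lookupD B' p   ≡⟨ lookupD-⊔ˡ A' B' p ⟨
  lookupD (A' ⊔ˡ B') p          ∎
  where open ≡-Reasoning

lookupD-≥ : ∀ A p → length A ≤ p → lookupD A p ≡ 0
lookupD-≥ []      p       _           = refl
lookupD-≥ (a ∷ A) (suc p) (s≤s |A|≤p) = lookupD-≥ A p |A|≤p

lookupD-map : ∀ {f : ℕ → ℕ} → f 0 ≡ 0 → ∀ A p → lookupD (map f A) p ≡ f (lookupD A p)
lookupD-map f0≡0 []      p       = sym f0≡0
lookupD-map f0≡0 (a ∷ A) zero    = refl
lookupD-map f0≡0 (a ∷ A) (suc p) = lookupD-map f0≡0 A p

map-≐ : ∀ {f : ℕ → ℕ} → f 0 ≡ 0 → ∀ {A B} → A ≐ B → map f A ≐ map f B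
map-≐ {f} f0≡0 {A} {B} A≐B = lookupD-≐ λ p → begin
  lookupD (map f A) p ≡⟨ lookupD-map f0≡0 A p ⟩
  f (lookupD A p)     ≡⟨ cong f (lookupD-≡ A≐B p) ⟩
  f (lookupD B p)     ≡⟨ lookupD-map f0≡0 B p ⟨
  lookupD (map f B) p ∎
  where open ≡-Reasoning

map-⊔ˡ : ∀ {f : ℕ → ℕ} → f 0 ≡ 0 → (∀ a b → f (a ⊔ b) ≡ f a ⊔ f b) →
         ∀ A B → map f (A ⊔ˡ B) ≐ map f A ⊔ˡ map f B
map-⊔ˡ {f} f0≡0 f-⊔ A B = lookupD-≐ λ p → begin
  lookupD (map f (A ⊔ˡ B)) p                ≡⟨ lookupD-map f0≡0 (A ⊔ˡ B) p ⟩
  f (lookupD (A ⊔ˡ B) p)                    ≡⟨ cong f (lookupD-⊔ˡ A B p) ⟩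
  f (lookupD A p ⊔ lookupD B p)             ≡⟨ f-⊔ _ _ ⟩
  f (lookupD A p) ⊔ f (lookupD B p)         ≡⟨ cong₂ _⊔_ (lookupD-map f0≡0 A p) (lookupD-map f0≡0 B p) ⟨
  lookupD (map f A) p ⊔ lookupD (map f B) p ≡⟨ lookupD-⊔ˡ (map f A) (map f B) p ⟨
  lookupD (map f A ⊔ˡ map f B) p            ∎
  where open ≡-Reasoning

map-replicate0 : ∀ {f : ℕ → ℕ} → f 0 ≡ 0 → ∀ K A → map f (replicate K 0 ++ A) ≡ replicate K 0 ++ map f A
map-replicate0 {f} f0≡0 K A = begin
  map f (replicate K 0 ++ A)       ≡⟨ map-++ f (replicate K 0) A ⟩
  map f (replicate K 0) ++ map f A ≡⟨ cong (_++ map f A) (map-replicate f K 0) ⟩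
  replicate K (f 0) ++ map f A     ≡⟨ cong (λ z → replicate K z ++ map f A) f0≡0 ⟩
  replicate K 0 ++ map f A         ∎
  where open ≡-Reasoning

sum-≐ : ∀ {A B} → A ≐ B → sum A ≡ sum B
sum-≐ {A} {B} A≐B = go A B (lookupD-≡ A≐B)
  where
  go : ∀ A B → (∀ p → lookupD A p ≡ lookupD B p) → sum A ≡ sum B
  go []      []      A≗B = refl
  go []      (b ∷ B) A≗B = cong₂ _+_ (A≗B zero) (go [] B (A≗B ∘ suc))
  go (a ∷ A) []      A≗B = cong₂ _+_ (A≗B zero) (go A [] (A≗B ∘ suc))
  go (a ∷ A) (b ∷ B) A≗B = cong₂ _+_ (A≗B zero) (go A B (A≗B ∘ suc))

sum-replicate0 : ∀ K A → sum (replicate K 0 ++ A) ≡ sum A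
sum-replicate0 zero    A = refl
sum-replicate0 (suc K) A = sum-replicate0 K A

superpose-≐ : ∀ {A B} → A ≐ B → ∀ S → superpose A S ≐ superpose B S
superpose-≐ A≐B []      = ≐-refl
superpose-≐ A≐B (b ∷ S) = ⊔ˡ-≐ (copy-≐ b) (∷-≐ 0 (superpose-≐ A≐B S))
  where
  copy-≐ : ∀ b → copy b _ ≐ copy b _
  copy-≐ true  = A≐B
  copy-≐ false = ≐-refl

superpose-map : ∀ {f : ℕ → ℕ} → f 0 ≡ 0 → (∀ a b → f (a ⊔ b) ≡ f a ⊔ f b) →
                ∀ A S → superpose (map f A) S ≐ map f (superpose A S)
superpose-map f0≡0 f-⊔ A []          = ≐-refl
superpose-map {f} f0≡0 f-⊔ A (b ∷ S) = begin
  copy b (map f A) ⊔ˡ (0 ∷ superpose (map f A) S)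
    ≈⟨ ⊔ˡ-≐ ≐-refl (∷-≐ 0 (superpose-map f0≡0 f-⊔ A S)) ⟩
  copy b (map f A) ⊔ˡ (0 ∷ map f (superpose A S))
    ≡⟨ cong₂ (λ x z → x ⊔ˡ (z ∷ map f (superpose A S))) (copy-map b) (sym f0≡0) ⟩
  map f (copy b A) ⊔ˡ map f (0 ∷ superpose A S)
    ≈⟨ map-⊔ˡ f0≡0 f-⊔ (copy b A) _ ⟨
  map f (copy b A ⊔ˡ (0 ∷ superpose A S)) ∎
  where
  open ≐-Reasoning
  copy-map : ∀ b → copy b (map f A) ≡ map f (copy b A)
  copy-map true  = refl
  copy-map false = refl

superpose-0∷ : ∀ A S → superpose (0 ∷ A) S ≐ 0 ∷ superpose A S
superpose-0∷ A []      = lookupD-≐ λ { zero → refl ; (suc p) → refl }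
superpose-0∷ A (b ∷ S) = ⊔ˡ-≐ (copy-0∷ b) (∷-≐ 0 (superpose-0∷ A S))
  where
  copy-0∷ : ∀ b → copy b (0 ∷ A) ≐ 0 ∷ copy b A
  copy-0∷ true  = ≐-refl
  copy-0∷ false = lookupD-≐ λ { zero → refl ; (suc p) → refl }

superpose-replicate0 : ∀ K A S → superpose (replicate K 0 ++ A) S ≐ replicate K 0 ++ superpose A S
superpose-replicate0 zero    A S = ≐-refl
superpose-replicate0 (suc K) A S = begin
  superpose (0 ∷ replicate K 0 ++ A) S ≈⟨ superpose-0∷ (replicate K 0 ++ A) S ⟩
  0 ∷ superpose (replicate K 0 ++ A) S ≈⟨ ∷-≐ 0 (superpose-replicate0 K A S) ⟩
  0 ∷ replicate K 0 ++ superpose A S   ∎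
  where open ≐-Reasoning

sum-superpose-replicate0 : ∀ {A B} K → A ≐ replicate K 0 ++ B → ∀ S → sum (superpose A S) ≡ sum (superpose B S)
sum-superpose-replicate0 {A} {B} K A≐0ᴷB S = begin
  sum (superpose A S)                  ≡⟨ sum-≐ (≐-trans (superpose-≐ A≐0ᴷB S) (superpose-replicate0 K B S)) ⟩
  sum (replicate K 0 ++ superpose B S) ≡⟨ sum-replicate0 K (superpose B S) ⟩
  sum (superpose B S)                  ∎
  where open ≡-Reasoning

ΣWord-⊆ˢ-occurrences : ∀ u n s S → length S ≡ n →
  ΣWord n s (λ w → 𝟙 (S ⊆ˢ occurrences u w)) ≡
  𝟙 (length (superpose u S) ≤ᵇ n) * #words∸ n s (excess (superpose u S))
ΣWord-⊆ˢ-occurrences u n s S |S| = trans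
  (ΣWord-cong n s λ w |w| → cong 𝟙 (⊆ˢ-occurrences u S w (trans |S| (sym |w|))))
  (ΣWord-prefixLE n s (superpose u S))

size : Subset → ℕ
size S = sum (map 𝟙 S)

η-occurrences : ∀ u → 1 ≤ length u → ∀ w → η u w ≡ size (occurrences u w)
η-occurrences (a ∷ u) _       []      = refl
η-occurrences (a ∷ u) 1≤|a∷u| (c ∷ w) = cong (𝟙 (prefixLE (a ∷ u) (c ∷ w)) +_) (η-occurrences (a ∷ u) 1≤|a∷u| w)

exactCount : Word → ℕ → ℕ → Subset → ℕ
exactCount u n s S = ΣWord n s (λ w → 𝟙 (occurrences u w =ˢ S))

ΣWord-by-occurrences : ∀ u n s (g : Subset → ℕ) →
  ΣWord n s (λ w → g (occurrences u w)) ≡ ΣSubset n (λ S → g S * exactCount u n s S)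
ΣWord-by-occurrences u n s g = begin
  ΣWord n s (λ w → g (occurrences u w))
    ≡⟨ ΣWord-cong n s expand ⟩
  ΣWord n s (λ w → ΣSubset n (λ S → 𝟙 (occurrences u w =ˢ S) * g S))
    ≡⟨ ΣWord-ΣSubset n s n _ ⟩
  ΣSubset n (λ S → ΣWord n s (λ w → 𝟙 (occurrences u w =ˢ S) * g S))
    ≡⟨ ΣSubset-cong n (λ S _ → trans (ΣWord-cong n s λ w _ → *-comm _ (g S)) (ΣWord-*ˡ n s (g S) _)) ⟩
  ΣSubset n (λ S → g S * exactCount u n s S) ∎
  where
  open ≡-Reasoning
  expand : ∀ w → length w ≡ n → g (occurrences u w) ≡ ΣSubset n (λ S → 𝟙 (occurrences u w =ˢ S) * g S)
  expand w |w| rewrite sym |w| | sym (length-occurrences u w) = sym (ΣSubset-=ˢ (occurrences u w) g)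

ΣWord-η : ∀ u → 1 ≤ length u → ∀ n s k →
  ΣWord n s (λ w → 𝟙 (does (η u w ≟ k))) ≡ ΣSubset n (λ S → 𝟙 (does (size S ≟ k)) * exactCount u n s S)
ΣWord-η u 1≤|u| n s k = trans
  (ΣWord-cong n s λ w _ → cong (λ x → 𝟙 (does (x ≟ k))) (η-occurrences u 1≤|u| w))
  (ΣWord-by-occurrences u n s (λ S → 𝟙 (does (size S ≟ k))))

ΣWord-⊆ˢ-upperSum : ∀ u n s S → ΣWord n s (λ w → 𝟙 (S ⊆ˢ occurrences u w)) ≡ upperSum n (exactCount u n s) S
ΣWord-⊆ˢ-upperSum u n s S = ΣWord-by-occurrences u n s (λ T → 𝟙 (S ⊆ˢ T))

ΣWord-η-cong : ∀ {u v} → 1 ≤ length u → 1 ≤ length v → ∀ n s →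
  (∀ S → length S ≡ n →
     ΣWord n s (λ w → 𝟙 (S ⊆ˢ occurrences u w)) ≡ ΣWord n s (λ w → 𝟙 (S ⊆ˢ occurrences v w))) →
  ∀ k → ΣWord n s (λ w → 𝟙 (does (η u w ≟ k))) ≡ ΣWord n s (λ w → 𝟙 (does (η v w ≟ k)))
ΣWord-η-cong {u} {v} 1≤|u| 1≤|v| n s ⊆ˢ-counts≡ k = begin
  ΣWord n s (λ w → 𝟙 (does (η u w ≟ k)))
    ≡⟨ ΣWord-η u 1≤|u| n s k ⟩
  ΣSubset n (λ S → 𝟙 (does (size S ≟ k)) * exactCount u n s S)
    ≡⟨ ΣSubset-cong n (λ S |S| → cong (𝟙 (does (size S ≟ k)) *_) (exactCount≡ S |S|)) ⟩
  ΣSubset n (λ S → 𝟙 (does (size S ≟ k)) * exactCount v n s S)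
    ≡⟨ ΣWord-η v 1≤|v| n s k ⟨
  ΣWord n s (λ w → 𝟙 (does (η v w ≟ k))) ∎
  where
  open ≡-Reasoning
  exactCount≡ : ∀ S → length S ≡ n → exactCount u n s S ≡ exactCount v n s S
  exactCount≡ = upperSum-injective n λ S |S| → begin
    upperSum n (exactCount u n s) S             ≡⟨ ΣWord-⊆ˢ-upperSum u n s S ⟨
    ΣWord n s (λ w → 𝟙 (S ⊆ˢ occurrences u w)) ≡⟨ ⊆ˢ-counts≡ S |S| ⟩
    ΣWord n s (λ w → 𝟙 (S ⊆ˢ occurrences v w)) ≡⟨ ΣWord-⊆ˢ-upperSum v n s S ⟩
    upperSum n (exactCount v n s) S             ∎

pred-split : ∀ {h} → 1 ≤ h → ∀ x → pred x ≡ pred (x ⊓ h) + (x ∸ h)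
pred-split {h} 1≤h x with ≤-total x h
pred-split {h} 1≤h x | inj₁ x≤h = begin
  pred x                  ≡⟨ +-identityʳ (pred x) ⟨
  pred x + 0              ≡⟨ cong₂ (λ y z → pred y + z) (m≤n⇒m⊓n≡m x≤h) (m≤n⇒m∸n≡0 x≤h) ⟨
  pred (x ⊓ h) + (x ∸ h)  ∎
  where open ≡-Reasoning
pred-split {suc h} _ (suc x) | inj₂ (s≤s h≤x) = begin
  x                 ≡⟨ m+[n∸m]≡n h≤x ⟨
  h + (x ∸ h)       ≡⟨ cong (_+ (x ∸ h)) (m≥n⇒m⊓n≡n h≤x) ⟨
  x ⊓ h + (x ∸ h)   ∎
  where open ≡-Reasoning

excess-split : ∀ {h} → 1 ≤ h → ∀ M → excess M ≡ excess (map (_⊓ h) M) + sum (map (_∸ h) M)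
excess-split 1≤h []      = refl
excess-split 1≤h (m ∷ M) = trans
  (cong₂ _+_ (pred-split 1≤h m) (excess-split 1≤h M))
  (+-interchange (pred (m ⊓ _)) _ _ _)

excess-≐ : ∀ {A B} → A ≐ B → excess A ≡ excess B
excess-≐ A≐B = sum-≐ (map-≐ refl A≐B)

Translated : Word → Word → Set
Translated A B = (Σ ℕ λ K → B ≐ replicate K 0 ++ A) ⊎ (Σ ℕ λ K → A ≐ replicate K 0 ++ B)

sum-superpose-Translated : ∀ {A B} → Translated A B → ∀ S → sum (superpose A S) ≡ sum (superpose B S)
sum-superpose-Translated (inj₁ (K , B≐0ᴷA)) S = sym (sum-superpose-replicate0 K B≐0ᴷA S)
sum-superpose-Translated (inj₂ (K , A≐0ᴷB)) S = sum-superpose-replicate0 K A≐0ᴷB S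

-- What a rigid shift at a given height preserves: the skyline below that height,
-- and the part above it up to translation.
record SkylineShift (u v : Word) : Set where
  field
    height   : ℕ
    1≤height : 1 ≤ height
    length≡  : length u ≡ length v
    base≐    : map (_⊓ height) u ≐ map (_⊓ height) v
    roof     : Translated (map (_∸ height) u) (map (_∸ height) v)

module _ {u v : Word} (σ : SkylineShift u v) where
  open SkylineShift σ renaming (height to h)

  excess-superpose : ∀ S → excess (superpose u S) ≡ excess (superpose v S)
  excess-superpose S = begin
    excess (superpose u S)
      ≡⟨ excess-split 1≤height (superpose u S) ⟩
    excess (map (_⊓ h) (superpose u S)) + sum (map (_∸ h) (superpose u S))
      ≡⟨ cong₂ _+_ (excess-≐ base) roof-sum ⟩
    excess (map (_⊓ h) (superpose v S)) + sum (map (_∸ h) (superpose v S))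
      ≡⟨ excess-split 1≤height (superpose v S) ⟨
    excess (superpose v S) ∎
    where
    open ≡-Reasoning
    base : map (_⊓ h) (superpose u S) ≐ map (_⊓ h) (superpose v S)
    base = ≐-trans (≐-sym (superpose-map refl (⊓-distribʳ-⊔ h) u S))
             (≐-trans (superpose-≐ base≐ S) (superpose-map refl (⊓-distribʳ-⊔ h) v S))
    roof-sum : sum (map (_∸ h) (superpose u S)) ≡ sum (map (_∸ h) (superpose v S))
    roof-sum = begin
      sum (map (_∸ h) (superpose u S))  ≡⟨ sum-≐ (superpose-map (0∸n≡0 h) (∸-distribʳ-⊔ h) u S) ⟨
      sum (superpose (map (_∸ h) u) S)  ≡⟨ sum-superpose-Translated roof S ⟩
      sum (superpose (map (_∸ h) v) S)  ≡⟨ sum-≐ (superpose-map (0∸n≡0 h) (∸-distribʳ-⊔ h) v S) ⟩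
      sum (map (_∸ h) (superpose v S))  ∎

  ΣWord-⊆ˢ-occurrences-shift : ∀ n s S → length S ≡ n →
    ΣWord n s (λ w → 𝟙 (S ⊆ˢ occurrences u w)) ≡ ΣWord n s (λ w → 𝟙 (S ⊆ˢ occurrences v w))
  ΣWord-⊆ˢ-occurrences-shift n s S |S| = begin
    ΣWord n s (λ w → 𝟙 (S ⊆ˢ occurrences u w))
      ≡⟨ ΣWord-⊆ˢ-occurrences u n s S |S| ⟩
    𝟙 (length (superpose u S) ≤ᵇ n) * #words∸ n s (excess (superpose u S))
      ≡⟨ cong₂ (λ ℓ e → 𝟙 (ℓ ≤ᵇ n) * #words∸ n s e) (length-superpose length≡ S) (excess-superpose S) ⟩
    𝟙 (length (superpose v S) ≤ᵇ n) * #words∸ n s (excess (superpose v S))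
      ≡⟨ ΣWord-⊆ˢ-occurrences v n s S |S| ⟨
    ΣWord n s (λ w → 𝟙 (S ⊆ˢ occurrences v w)) ∎
    where open ≡-Reasoning

Words : ℕ → ℕ → (Word → Set) → Set
Words n s P = Σ Word λ w → Positive w × length w ≡ n × sum w ≡ s × P w

Words-≡ : ∀ {n s} {P : Word → Set} → (∀ {w} → Irrelevant (P w)) →
          {x y : Words n s P} → proj₁ x ≡ proj₁ y → x ≡ y
Words-≡ P-irr {w , p , l , σ , q} {.w , p' , l' , σ' , q'} refl
  rewrite All.irrelevant ≤-irrelevant p p' | ≡-irrelevant l l' | ≡-irrelevant σ σ' | P-irr q q' = refl

module _ {P : Word → Set} (P-irr : ∀ {w} → Irrelevant (P w)) where

  Words-[] : Words 0 0 P ↔ P []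
  Words-[] = mk↔ₛ′ to (λ q → [] , [] , refl , refl , q) (λ _ → refl) from∘to
    where
    to : Words 0 0 P → P []
    to ([]    , _ , _  , _ , q) = q
    to (_ ∷ _ , _ , () , _ , _)
    from∘to : ∀ x → ([] , [] , refl , refl , to x) ≡ x
    from∘to ([]    , _ , _  , _ , _) = Words-≡ P-irr refl
    from∘to (_ ∷ _ , _ , () , _ , _)

  Words-split : ∀ n s → Words (suc n) (suc s) P ↔ (Words n s (P ∘ (1 ∷_)) ⊎ Words (suc n) s (P ∘ incrHead))
  Words-split n s = mk↔ₛ′ to from to∘from from∘to
    where
    to : Words (suc n) (suc s) P → Words n s (P ∘ (1 ∷_)) ⊎ Words (suc n) s (P ∘ incrHead)
    to ([]               , _         , () , _ , _)
    to (zero ∷ w         , (() ∷ _)  , _  , _ , _)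
    to (suc zero ∷ w     , (_ ∷ p)   , l  , σ , q) = inj₁ (w , p , suc-injective l , suc-injective σ , q)
    to (suc (suc c) ∷ w  , (_ ∷ p)   , l  , σ , q) = inj₂ (suc c ∷ w , s≤s z≤n ∷ p , l , suc-injective σ , q)
    from : Words n s (P ∘ (1 ∷_)) ⊎ Words (suc n) s (P ∘ incrHead) → Words (suc n) (suc s) P
    from (inj₁ (w , p , l , σ , q))     = 1 ∷ w , s≤s z≤n ∷ p , cong suc l , cong suc σ , q
    from (inj₂ ([]    , _ , () , _ , _))
    from (inj₂ (c ∷ w , (_ ∷ p) , l , σ , q)) = suc c ∷ w , s≤s z≤n ∷ p , l , cong suc σ , q
    to∘from : ∀ y → to (from y) ≡ y
    to∘from (inj₁ _)                                 = cong inj₁ (Words-≡ P-irr refl)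
    to∘from (inj₂ ([]          , _ , () , _ , _))
    to∘from (inj₂ (zero ∷ w    , (() ∷ _) , _ , _ , _))
    to∘from (inj₂ (suc c ∷ w   , (_ ∷ _) , _ , _ , _)) = cong inj₂ (Words-≡ P-irr refl)
    from∘to : ∀ x → from (to x) ≡ x
    from∘to ([]              , _        , () , _ , _)
    from∘to (zero ∷ w        , (() ∷ _) , _  , _ , _)
    from∘to (suc zero ∷ w    , (_ ∷ _)  , _  , _ , _) = Words-≡ P-irr refl
    from∘to (suc (suc c) ∷ w , (_ ∷ _)  , _  , _ , _) = Words-≡ P-irr refl

Dec↔Fin𝟙 : ∀ {A : Set} → Irrelevant A → (a? : Dec A) → A ↔ Fin (𝟙 (does a?))
Dec↔Fin𝟙 A-irr (yes a) = mk↔ₛ′ (λ _ → Fin.zero) (λ _ → a) (λ { Fin.zero → refl ; (Fin.suc ()) }) (A-irr a)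
Dec↔Fin𝟙 A-irr (no ¬a) = mk↔ₛ′ (λ a → contradiction a ¬a) (λ ()) (λ ()) (λ a → contradiction a ¬a)

¬↔Fin0 : ∀ {A : Set} → ¬ A → A ↔ Fin 0
¬↔Fin0 ¬a = mk↔ₛ′ (λ a → contradiction a ¬a) (λ ()) (λ ()) (λ a → contradiction a ¬a)

Words↔Fin : ∀ n s {P : Word → Set} (P? : U.Decidable P) → (∀ {w} → Irrelevant (P w)) →
            Words n s P ↔ Fin (ΣWord n s (λ w → 𝟙 (does (P? w))))
Words↔Fin zero    zero    P? P-irr = ↔-trans (Words-[] P-irr) (Dec↔Fin𝟙 P-irr (P? []))
Words↔Fin zero    (suc s) P? P-irr = ¬↔Fin0 λ { ([] , _ , _ , () , _) ; (_ ∷ _ , _ , () , _ , _) }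
Words↔Fin (suc n) zero    P? P-irr =
  ¬↔Fin0 λ { ([] , _ , () , _ , _) ; (zero ∷ _ , (() ∷ _) , _) ; (suc _ ∷ _ , _ , _ , () , _) }
Words↔Fin (suc n) (suc s) P? P-irr = ↔-trans (Words-split P-irr n s) (↔-trans
  (Words↔Fin n s (P? ∘ (1 ∷_)) P-irr ⊎-↔ Words↔Fin (suc n) s (P? ∘ incrHead) P-irr)
  (↔-sym Finₚ.+↔⊎))

Coeff↔Fin : ∀ u n s k → Coeff u n s k ↔ Fin (ΣWord n s (λ w → 𝟙 (does (η u w ≟ k))))
Coeff↔Fin u n s k = Words↔Fin n s (λ w → η u w ≟ k) ≡-irrelevant

-- Reversal

prefixLE-short : ∀ a b → length b < length a → prefixLE a b ≡ false
prefixLE-short (x ∷ a) []      _           = refl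
prefixLE-short (x ∷ a) (y ∷ b) (s≤s |b|<|a|) =
  trans (cong (⌊ x ℕ.≤? y ⌋ ∧_) (prefixLE-short a b |b|<|a|)) (Bool.∧-zeroʳ _)

prefixLE-short-reverse : ∀ r y → length y < length r → prefixLE (reverse r) y ≡ false
prefixLE-short-reverse r y |y|<|r| =
  prefixLE-short (reverse r) y (subst (length y <_) (sym (length-reverse r)) |y|<|r|)

prefixLE-++ : ∀ a b z → length a ≤ length b → prefixLE a (b ++ z) ≡ prefixLE a b
prefixLE-++ []      b       z _             = refl
prefixLE-++ (x ∷ a) (y ∷ b) z (s≤s |a|≤|b|) = cong (⌊ x ℕ.≤? y ⌋ ∧_) (prefixLE-++ a b z |a|≤|b|)

prefixLE-∷ʳ : ∀ a b x y → length a ≡ length b →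
              prefixLE (a ∷ʳ x) (b ∷ʳ y) ≡ prefixLE a b ∧ ⌊ x ℕ.≤? y ⌋
prefixLE-∷ʳ []      []      x y _ = Bool.∧-identityʳ _
prefixLE-∷ʳ (c ∷ a) (d ∷ b) x y |a|≡|b| = trans
  (cong (⌊ c ℕ.≤? d ⌋ ∧_) (prefixLE-∷ʳ a b x y (suc-injective |a|≡|b|)))
  (sym (Bool.∧-assoc ⌊ c ℕ.≤? d ⌋ (prefixLE a b) _))

prefixLE-reverse : ∀ a b → length a ≡ length b → prefixLE (reverse a) (reverse b) ≡ prefixLE a b
prefixLE-reverse []      []      _       = refl
prefixLE-reverse (x ∷ a) (y ∷ b) |a|≡|b| = begin
  prefixLE (reverse (x ∷ a)) (reverse (y ∷ b))
    ≡⟨ cong₂ prefixLE (unfold-reverse x a) (unfold-reverse y b) ⟩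
  prefixLE (reverse a ∷ʳ x) (reverse b ∷ʳ y)
    ≡⟨ prefixLE-∷ʳ (reverse a) (reverse b) x y |rev-a|≡|rev-b| ⟩
  prefixLE (reverse a) (reverse b) ∧ ⌊ x ℕ.≤? y ⌋
    ≡⟨ cong (_∧ ⌊ x ℕ.≤? y ⌋) (prefixLE-reverse a b (suc-injective |a|≡|b|)) ⟩
  prefixLE a b ∧ ⌊ x ℕ.≤? y ⌋
    ≡⟨ Bool.∧-comm (prefixLE a b) _ ⟩
  prefixLE (x ∷ a) (y ∷ b) ∎
  where
  open ≡-Reasoning
  |rev-a|≡|rev-b| : length (reverse a) ≡ length (reverse b)
  |rev-a|≡|rev-b| = trans (length-reverse a) (trans (suc-injective |a|≡|b|) (sym (length-reverse b)))

length-∷ʳ : ∀ (a : Word) x → length (a ∷ʳ x) ≡ suc (length a)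
length-∷ʳ a x = trans (length-++ a) (+-comm (length a) 1)

length-∷-reverse : ∀ c (x : Word) → length (c ∷ reverse x) ≡ suc (length x)
length-∷-reverse c x = cong suc (length-reverse x)

prefixLE-∷ʳ-reverse : ∀ r y c → length r ≡ suc (length y) →
                      prefixLE r (y ∷ʳ c) ≡ prefixLE (reverse r) (c ∷ reverse y)
prefixLE-∷ʳ-reverse r y c |r|≡1+|y| = trans
  (sym (prefixLE-reverse r (y ∷ʳ c) (trans |r|≡1+|y| (sym (length-∷ʳ y c)))))
  (cong (prefixLE (reverse r)) (reverse-++ y (c ∷ [])))

prefixLE-reverse-singleton : ∀ r c → prefixLE (reverse r) (c ∷ []) ≡ prefixLE r (c ∷ [])
prefixLE-reverse-singleton []           c = refl
prefixLE-reverse-singleton (a ∷ [])     c = refl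
prefixLE-reverse-singleton (a ∷ a' ∷ r) c = trans
  (prefixLE-short-reverse (a ∷ a' ∷ r) (c ∷ []) (s≤s (s≤s z≤n)))
  (sym (prefixLE-short (a ∷ a' ∷ r) (c ∷ []) (s≤s (s≤s z≤n))))

-- Appending c to b ∷ x creates exactly one new window, the one ending at c; read backwards
-- it is the window starting at c.
prefixLE-last-window : ∀ r b x c →
  𝟙 (prefixLE r ((b ∷ x) ∷ʳ c)) + 𝟙 (prefixLE (reverse r) (c ∷ reverse x)) ≡
  𝟙 (prefixLE r (b ∷ x)) + 𝟙 (prefixLE (reverse r) (c ∷ reverse (b ∷ x)))
prefixLE-last-window r b x c with <-cmp (length r) (2 + length x)
... | tri< |r|<2+|x| _ _ = cong₂ (λ p q → 𝟙 p + 𝟙 q)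
  (prefixLE-++ r (b ∷ x) (c ∷ []) |r|≤1+|x|)
  (sym (trans (cong (prefixLE (reverse r) ∘ (c ∷_)) (unfold-reverse b x))
              (prefixLE-++ (reverse r) (c ∷ reverse x) (b ∷ [])
                (subst₂ _≤_ (sym (length-reverse r)) (sym (length-∷-reverse c x)) |r|≤1+|x|))))
  where
  |r|≤1+|x| : length r ≤ suc (length x)
  |r|≤1+|x| = ≤-pred |r|<2+|x|
... | tri≈ _ |r|≡2+|x| _ = begin
  𝟙 (prefixLE r ((b ∷ x) ∷ʳ c)) + 𝟙 (prefixLE (reverse r) (c ∷ reverse x))
    ≡⟨ cong (λ p → 𝟙 (prefixLE r ((b ∷ x) ∷ʳ c)) + 𝟙 p) (prefixLE-short-reverse r (c ∷ reverse x) |c∷rev-x|<|r|) ⟩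
  𝟙 (prefixLE r ((b ∷ x) ∷ʳ c)) + 0
    ≡⟨ +-identityʳ _ ⟩
  𝟙 (prefixLE r ((b ∷ x) ∷ʳ c))
    ≡⟨ cong 𝟙 (prefixLE-∷ʳ-reverse r (b ∷ x) c |r|≡2+|x|) ⟩
  𝟙 (prefixLE (reverse r) (c ∷ reverse (b ∷ x)))
    ≡⟨ cong (λ p → 𝟙 p + 𝟙 (prefixLE (reverse r) (c ∷ reverse (b ∷ x))))
            (prefixLE-short r (b ∷ x) (≤-reflexive (sym |r|≡2+|x|))) ⟨
  𝟙 (prefixLE r (b ∷ x)) + 𝟙 (prefixLE (reverse r) (c ∷ reverse (b ∷ x))) ∎
  where
  open ≡-Reasoning
  |c∷rev-x|<|r| : length (c ∷ reverse x) < length r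
  |c∷rev-x|<|r| = subst₂ _<_ (sym (length-∷-reverse c x)) (sym |r|≡2+|x|) ≤-refl
... | tri> _ _ 2+|x|<|r| =
  trans (cong₂ (λ p q → 𝟙 p + 𝟙 q) p₁ q₁) (sym (cong₂ (λ p q → 𝟙 p + 𝟙 q) p₀ q₀))
  where
  1+|x|<|r| : suc (length x) < length r
  1+|x|<|r| = <-trans (n<1+n _) 2+|x|<|r|
  p₁ : prefixLE r ((b ∷ x) ∷ʳ c) ≡ false
  p₁ = prefixLE-short r _ (subst (_< length r) (sym (length-∷ʳ (b ∷ x) c)) 2+|x|<|r|)
  q₁ : prefixLE (reverse r) (c ∷ reverse x) ≡ false
  q₁ = prefixLE-short-reverse r _ (subst (_< length r) (sym (length-∷-reverse c x)) 1+|x|<|r|)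
  p₀ : prefixLE r (b ∷ x) ≡ false
  p₀ = prefixLE-short r (b ∷ x) 1+|x|<|r|
  q₀ : prefixLE (reverse r) (c ∷ reverse (b ∷ x)) ≡ false
  q₀ = prefixLE-short-reverse r _ (subst (_< length r) (sym (length-∷-reverse c (b ∷ x))) 2+|x|<|r|)

η-∷ʳ : ∀ r → 1 ≤ length r → ∀ x c → η r (x ∷ʳ c) ≡ η r x + 𝟙 (prefixLE (reverse r) (c ∷ reverse x))
η-∷ʳ (a ∷ r) _ []      c = trans (+-identityʳ _) (cong 𝟙 (sym (prefixLE-reverse-singleton (a ∷ r) c)))
η-∷ʳ r 1≤|r| (b ∷ x) c = begin
  P₁ + η r (x ∷ʳ c)  ≡⟨ cong (P₁ +_) (η-∷ʳ r 1≤|r| x c) ⟩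
  P₁ + (η r x + Q₁)  ≡⟨ x∙yz≈xz∙y P₁ (η r x) Q₁ ⟩
  (P₁ + Q₁) + η r x  ≡⟨ cong (_+ η r x) (prefixLE-last-window r b x c) ⟩
  (P₀ + Q₀) + η r x  ≡⟨ xy∙z≈xz∙y P₀ Q₀ (η r x) ⟩
  (P₀ + η r x) + Q₀  ∎
  where
  open ≡-Reasoning
  P₁ = 𝟙 (prefixLE r ((b ∷ x) ∷ʳ c))
  Q₁ = 𝟙 (prefixLE (reverse r) (c ∷ reverse x))
  P₀ = 𝟙 (prefixLE r (b ∷ x))
  Q₀ = 𝟙 (prefixLE (reverse r) (c ∷ reverse (b ∷ x)))

η-reverse : ∀ u → 1 ≤ length u → ∀ w → η (reverse u) (reverse w) ≡ η u w
η-reverse (a ∷ u) _ [] = cong 𝟙 (prefixLE-short-reverse (a ∷ u) [] (s≤s z≤n))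
η-reverse u 1≤|u| (c ∷ w) = begin
  η (reverse u) (reverse (c ∷ w))
    ≡⟨ cong (η (reverse u)) (unfold-reverse c w) ⟩
  η (reverse u) (reverse w ∷ʳ c)
    ≡⟨ η-∷ʳ (reverse u) (subst (1 ≤_) (sym (length-reverse u)) 1≤|u|) (reverse w) c ⟩
  η (reverse u) (reverse w) + 𝟙 (prefixLE (reverse (reverse u)) (c ∷ reverse (reverse w)))
    ≡⟨ cong₂ (λ r z → η (reverse u) (reverse w) + 𝟙 (prefixLE r (c ∷ z)))
             (reverse-involutive u) (reverse-involutive w) ⟩
  η (reverse u) (reverse w) + 𝟙 (prefixLE u (c ∷ w))
    ≡⟨ cong (_+ 𝟙 (prefixLE u (c ∷ w))) (η-reverse u 1≤|u| w) ⟩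
  η u w + 𝟙 (prefixLE u (c ∷ w))
    ≡⟨ +-comm (η u w) _ ⟩
  η u (c ∷ w) ∎
  where open ≡-Reasoning

Coeff-reverse : ∀ u → 1 ≤ length u → ∀ n s k → Coeff u n s k ↔ Coeff (reverse u) n s k
Coeff-reverse u 1≤|u| n s k = mk↔ₛ′ to from
  (λ x → Words-≡ ≡-irrelevant (reverse-involutive (proj₁ x)))
  (λ x → Words-≡ ≡-irrelevant (reverse-involutive (proj₁ x)))
  where
  reverse-word : ∀ {n s} {P Q : Word → Set} → (∀ {w} → P w → Q (reverse w)) → Words n s P → Words n s Q
  reverse-word P⇒Q (w , p , l , σ , q) =
    reverse w , All-resp-↭ (↭-sym (↭-reverse w)) p , trans (length-reverse w) l ,
    trans (sum-↭ (↭-reverse w)) σ , P⇒Q q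
  to : Coeff u n s k → Coeff (reverse u) n s k
  to = reverse-word λ {w} ηw≡k → trans (η-reverse u 1≤|u| w) ηw≡k
  from : Coeff (reverse u) n s k → Coeff u n s k
  from = reverse-word λ {w} ηw≡k → trans (sym (η-reverse u 1≤|u| (reverse w)))
                                          (trans (cong (η (reverse u)) (reverse-involutive w)) ηw≡k)

-- Rigid shifts

lookupD-applyUpTo : ∀ (g : ℕ → ℕ) m p → p < m → lookupD (applyUpTo g m) p ≡ g p
lookupD-applyUpTo g (suc m) zero    _         = refl
lookupD-applyUpTo g (suc m) (suc p) (s≤s p<m) = lookupD-applyUpTo (g ∘ suc) m p p<m

lookupD-replicate0-+ : ∀ K X p → lookupD (replicate K 0 ++ X) (K + p) ≡ lookupD X p
lookupD-replicate0-+ zero    X p = refl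
lookupD-replicate0-+ (suc K) X p = lookupD-replicate0-+ K X p

lookupD-replicate0-< : ∀ K X q → q < K → lookupD (replicate K 0 ++ X) q ≡ 0
lookupD-replicate0-< (suc K) X zero    _         = refl
lookupD-replicate0-< (suc K) X (suc q) (s≤s q<K) = lookupD-replicate0-< K X q q<K

at-⊖ : ∀ u p K → at u (suc p ⊖ K) ≡ lookupD (replicate K 0 ++ u) p
at-⊖ u p       zero          = refl
at-⊖ u zero    (suc zero)    = refl
at-⊖ u zero    (suc (suc K)) = refl
at-⊖ u (suc p) (suc K)       = trans (cong (at u) (ℤₚ.[1+m]⊖[1+n]≡m⊖n (suc p) K)) (at-⊖ u p K)

⊖-nonpositive : ∀ {a b} → a ≤ b → ¬ (ℤ.+ 1 ℤ.≤ a ⊖ b)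
⊖-nonpositive {a} {b} a≤b 1≤a⊖b
  with ℤₚ.drop‿+≤+ (ℤₚ.≤-trans 1≤a⊖b (subst (ℤ._≤ ℤ.+ 0) (sym (ℤₚ.⊖-≤ a≤b)) ℤₚ.neg-≤-pos))
... | ()

⊓-restack : ∀ {h a b} → (h < b → h ≤ a) → (h ⊓ a + (b ∸ h)) ⊓ h ≡ a ⊓ h
⊓-restack {h} {a} {b} lands with b ≤? h
... | yes b≤h = begin
  (h ⊓ a + (b ∸ h)) ⊓ h ≡⟨ cong (λ z → (h ⊓ a + z) ⊓ h) (m≤n⇒m∸n≡0 b≤h) ⟩
  (h ⊓ a + 0) ⊓ h       ≡⟨ cong (_⊓ h) (+-identityʳ (h ⊓ a)) ⟩
  (h ⊓ a) ⊓ h           ≡⟨ m≤n⇒m⊓n≡m (m⊓n≤m h a) ⟩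
  h ⊓ a                 ≡⟨ ⊓-comm h a ⟩
  a ⊓ h                 ∎
  where open ≡-Reasoning
... | no b≰h = begin
  (h ⊓ a + (b ∸ h)) ⊓ h ≡⟨ cong (λ z → (z + (b ∸ h)) ⊓ h) (m≤n⇒m⊓n≡m h≤a) ⟩
  (h + (b ∸ h)) ⊓ h     ≡⟨ m≥n⇒m⊓n≡n (m≤m+n h (b ∸ h)) ⟩
  h                     ≡⟨ m≥n⇒m⊓n≡n h≤a ⟨
  a ⊓ h                 ∎
  where
  open ≡-Reasoning
  h≤a : h ≤ a
  h≤a = lands (≰⇒> b≰h)

∸-restack : ∀ {h a b} → (h < b → h ≤ a) → (h ⊓ a + (b ∸ h)) ∸ h ≡ b ∸ h
∸-restack {h} {a} {b} lands with b ≤? h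
... | yes b≤h = begin
  (h ⊓ a + (b ∸ h)) ∸ h ≡⟨ cong (λ z → (h ⊓ a + z) ∸ h) (m≤n⇒m∸n≡0 b≤h) ⟩
  (h ⊓ a + 0) ∸ h       ≡⟨ cong (_∸ h) (+-identityʳ (h ⊓ a)) ⟩
  h ⊓ a ∸ h             ≡⟨ m≤n⇒m∸n≡0 (m⊓n≤m h a) ⟩
  0                     ≡⟨ m≤n⇒m∸n≡0 b≤h ⟨
  b ∸ h                 ∎
  where open ≡-Reasoning
... | no b≰h = begin
  (h ⊓ a + (b ∸ h)) ∸ h ≡⟨ cong (λ z → (z + (b ∸ h)) ∸ h) (m≤n⇒m⊓n≡m (lands (≰⇒> b≰h))) ⟩
  (h + (b ∸ h)) ∸ h     ≡⟨ m+n∸m≡n h (b ∸ h) ⟩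
  b ∸ h                 ∎
  where open ≡-Reasoning

-- The height of the column of u that a shift by k moves onto position p (0-indexed).
source : Word → ℤ → ℕ → ℕ
source u k p = at u (ℤ.+ suc p ℤ.- k)

lookupD-shift : ∀ u h k p → p < length u → lookupD (shift u h k) p ≡ h ⊓ lookupD u p + (source u k p ∸ h)
lookupD-shift u h k p = lookupD-applyUpTo _ (length u) p

lookupD-shift-≥ : ∀ u h k p → length u ≤ p → lookupD (shift u h k) p ≡ 0
lookupD-shift-≥ u h k p |u|≤p =
  lookupD-≥ (shift u h k) p (subst (_≤ p) (sym (length-applyUpTo _ (length u))) |u|≤p)

module _ {u : Word} {h : ℕ} {k : ℤ} (adm : Admissible u h k) where

  source-admissible : ∀ p → h < source u k p → p < length u × h ≤ lookupD u p
  source-admissible p h<src with adm (ℤ.+ suc p ℤ.- k) h<src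
  ... | _ , ≤|u| , h≤ = ℤₚ.drop‿+≤+ (subst (ℤ._≤ ℤ.+ length u) lands ≤|u|) , subst (λ n → h ≤ at u n) lands h≤
    where
    lands : ℤ.+ suc p ℤ.- k ℤ.+ k ≡ ℤ.+ suc p
    lands = //-rightDividesˡ k (ℤ.+ suc p)

  shift-⊓ : ∀ p → lookupD (shift u h k) p ⊓ h ≡ lookupD u p ⊓ h
  shift-⊓ p with p <? length u
  ... | yes p<|u| = trans (cong (_⊓ h) (lookupD-shift u h k p p<|u|)) (⊓-restack (proj₂ ∘ source-admissible p))
  ... | no  p≮|u| =
    cong (_⊓ h) (trans (lookupD-shift-≥ u h k p (≮⇒≥ p≮|u|)) (sym (lookupD-≥ u p (≮⇒≥ p≮|u|))))

  shift-∸ : ∀ p → lookupD (shift u h k) p ∸ h ≡ source u k p ∸ h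
  shift-∸ p with p <? length u
  ... | yes p<|u| = trans (cong (_∸ h) (lookupD-shift u h k p p<|u|)) (∸-restack (proj₂ ∘ source-admissible p))
  ... | no  p≮|u| = begin
    lookupD (shift u h k) p ∸ h ≡⟨ cong (_∸ h) (lookupD-shift-≥ u h k p (≮⇒≥ p≮|u|)) ⟩
    0 ∸ h                       ≡⟨ 0∸n≡0 h ⟩
    0                           ≡⟨ m≤n⇒m∸n≡0 (≮⇒≥ (p≮|u| ∘ proj₁ ∘ source-admissible p)) ⟨
    source u k p ∸ h            ∎
    where open ≡-Reasoning

  base≐-shift : map (_⊓ h) u ≐ map (_⊓ h) (shift u h k)
  base≐-shift = lookupD-≐ λ p →
    trans (lookupD-map refl u p) (trans (sym (shift-⊓ p)) (sym (lookupD-map refl (shift u h k) p)))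

  roof-shift : ∀ p → lookupD (map (_∸ h) (shift u h k)) p ≡ source u k p ∸ h
  roof-shift p = trans (lookupD-map (0∸n≡0 h) (shift u h k) p) (shift-∸ p)

roof-Translated : ∀ {u h} k → Admissible u h k → Translated (map (_∸ h) u) (map (_∸ h) (shift u h k))
roof-Translated {u} {h} (ℤ.+ K) adm = inj₁ (K , lookupD-≐ λ p → begin
  lookupD (map (_∸ h) (shift u h (ℤ.+ K))) p  ≡⟨ roof-shift adm p ⟩
  at u (ℤ.+ suc p ℤ.- ℤ.+ K) ∸ h              ≡⟨ cong (λ n → at u n ∸ h) (ℤₚ.m-n≡m⊖n (suc p) K) ⟩
  at u (suc p ⊖ K) ∸ h                        ≡⟨ cong (_∸ h) (at-⊖ u p K) ⟩
  lookupD (replicate K 0 ++ u) p ∸ h          ≡⟨ lookupD-map (0∸n≡0 h) (replicate K 0 ++ u) p ⟨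
  lookupD (map (_∸ h) (replicate K 0 ++ u)) p ≡⟨ cong (λ X → lookupD X p) (map-replicate0 (0∸n≡0 h) K u) ⟩
  lookupD (replicate K 0 ++ map (_∸ h) u) p   ∎)
  where open ≡-Reasoning
roof-Translated {u} {h} -[1+ K' ] adm = inj₂ (K , lookupD-≐ λ q → go q (q <? K))
  where
  open ≡-Reasoning
  K : ℕ
  K = suc K'
  v : Word
  v = shift u h -[1+ K' ]
  below : ∀ q → q < K → lookupD u q ≤ h
  below q q<K = ≮⇒≥ λ h<uq → ⊖-nonpositive q<K (proj₁ (adm (ℤ.+ suc q) h<uq))
  past : ∀ p → lookupD (map (_∸ h) u) (K + p) ≡ lookupD (replicate K 0 ++ map (_∸ h) v) (K + p)
  past p = begin
    lookupD (map (_∸ h) u) (K + p)                 ≡⟨ lookupD-map (0∸n≡0 h) u (K + p) ⟩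
    lookupD u (K + p) ∸ h                          ≡⟨ cong (λ i → lookupD u i ∸ h) (+-comm K p) ⟩
    source u -[1+ K' ] p ∸ h                       ≡⟨ roof-shift adm p ⟨
    lookupD (map (_∸ h) v) p                       ≡⟨ lookupD-replicate0-+ K (map (_∸ h) v) p ⟨
    lookupD (replicate K 0 ++ map (_∸ h) v) (K + p) ∎
  go : ∀ q → Dec (q < K) → lookupD (map (_∸ h) u) q ≡ lookupD (replicate K 0 ++ map (_∸ h) v) q
  go q (yes q<K) = begin
    lookupD (map (_∸ h) u) q                    ≡⟨ lookupD-map (0∸n≡0 h) u q ⟩
    lookupD u q ∸ h                             ≡⟨ m≤n⇒m∸n≡0 (below q q<K) ⟩
    0                                           ≡⟨ lookupD-replicate0-< K (map (_∸ h) v) q q<K ⟨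
    lookupD (replicate K 0 ++ map (_∸ h) v) q   ∎
  go q (no q≮K) = subst (λ i → lookupD (map (_∸ h) u) i ≡ lookupD (replicate K 0 ++ map (_∸ h) v) i)
                        (m+[n∸m]≡n (≮⇒≥ q≮K)) (past (q ∸ K))

RigidShift⇒SkylineShift : ∀ {u v} → RigidShift u v → SkylineShift u v
RigidShift⇒SkylineShift {u} (h , 1≤h , k , adm , refl) = record
  { height   = h
  ; 1≤height = 1≤h
  ; length≡  = sym (length-applyUpTo _ (length u))
  ; base≐    = base≐-shift adm
  ; roof     = roof-Translated k adm
  }

Fin-cong : ∀ {m n} → m ≡ n → Fin m ↔ Fin n
Fin-cong refl = ↔-refl

StronglyWilfEquivalent-sym : ∀ {u v} → StronglyWilfEquivalent u v → StronglyWilfEquivalent v u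
StronglyWilfEquivalent-sym u~v n s k = ↔-sym (u~v n s k)

StronglyWilfEquivalent-trans : ∀ {u v w} → StronglyWilfEquivalent u v → StronglyWilfEquivalent v w →
                               StronglyWilfEquivalent u w
StronglyWilfEquivalent-trans u~v v~w n s k = ↔-trans (u~v n s k) (v~w n s k)

SkylineShift⇒StronglyWilfEquivalent : ∀ {u v} → SkylineShift u v → 1 ≤ length u → 1 ≤ length v →
                                      StronglyWilfEquivalent u v
SkylineShift⇒StronglyWilfEquivalent {u} {v} σ 1≤|u| 1≤|v| n s k =
  ↔-trans (Coeff↔Fin u n s k)
    (↔-trans (Fin-cong (ΣWord-η-cong 1≤|u| 1≤|v| n s (ΣWord-⊆ˢ-occurrences-shift σ n s) k))
             (↔-sym (Coeff↔Fin v n s k)))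

Step⇒StronglyWilfEquivalent : ∀ {u v} → 1 ≤ length u → Step u v → StronglyWilfEquivalent u v × 1 ≤ length v
Step⇒StronglyWilfEquivalent {u} 1≤|u| (inj₁ refl) =
  Coeff-reverse u 1≤|u| , subst (1 ≤_) (sym (length-reverse u)) 1≤|u|
Step⇒StronglyWilfEquivalent {u} {v} 1≤|u| (inj₂ u⇝v) =
  SkylineShift⇒StronglyWilfEquivalent σ 1≤|u| 1≤|v| , 1≤|v|
  where
  σ : SkylineShift u v
  σ = RigidShift⇒SkylineShift u⇝v
  1≤|v| : 1 ≤ length v
  1≤|v| = subst (1 ≤_) (SkylineShift.length≡ σ) 1≤|u|

Star⇒StronglyWilfEquivalent : ∀ {u v} → 1 ≤ length u → Star Step u v → StronglyWilfEquivalent u v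
Star⇒StronglyWilfEquivalent _     ε                = λ _ _ _ → ↔-refl
Star⇒StronglyWilfEquivalent 1≤|u| (u⇝v ◅ v⇝⋆w) =
  let u~v , 1≤|v| = Step⇒StronglyWilfEquivalent 1≤|u| u⇝v
  in StronglyWilfEquivalent-trans u~v (Star⇒StronglyWilfEquivalent 1≤|v| v⇝⋆w)

mainTheorem1 : (u v : Word) → Nonempty u → Nonempty v → Positive u → Positive v →
    ShiftEquivalent u v → StronglyWilfEquivalent u v
mainTheorem1 u v 1≤|u| 1≤|v| _ _ (inj₁ u⇝⋆v) = Star⇒StronglyWilfEquivalent 1≤|u| u⇝⋆v
mainTheorem1 u v 1≤|u| 1≤|v| _ _ (inj₂ v⇝⋆u) =
  StronglyWilfEquivalent-sym (Star⇒StronglyWilfEquivalent 1≤|v| v⇝⋆u)
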